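{- Let $m\ge1$, let $\pi\colon\mathbb F_2^m\to\mathbb F_2^m$ be a permutation and $\phi\colon\mathbb F_2^m\to\mathbb F_2$, and let $h_{\pi,\phi}(\mathbf{x},\mathbf{y})=\langle\mathbf{x},\pi(\mathbf{y})\rangle_m\oplus\phi(\mathbf{y})$ be the corresponding Maiorana–McFarland bent function on $\mathbb F_2^{2m}$. Suppose there is an invertible $2m\times 2m$ binary matrix $T$ such that $h_{\pi,\phi}((\mathbf{x},\mathbf{y})T)$ is a $d$-homogeneous bent function. Then the set $$\Omega_T(h_{\pi,\phi})=\{\omega\colon\mathbb F_2^m\to\mathbb F_2 \mid h_{\pi,\phi\oplus\omega}((\mathbf{x},\mathbf{y})T)\text{ is a }d\text{ -homogeneous bent function}\}$$ is a vector space over $\mathbb F_2$ (with respect to pointwise addition of functions).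
   Context: $\langle\mathbf{x},\mathbf{z}\rangle_m=\sum_{i=1}^m x_iz_i$ over $\mathbb F_2$. For $\psi\colon\mathbb F_2^m\to\mathbb F_2$, $h_{\pi,\psi}(\mathbf{x},\mathbf{y})=\langle\mathbf{x},\pi(\mathbf{y})\rangle_m\oplus\psi(\mathbf{y})$. A Boolean function is $d$-homogeneous if all monomials of its algebraic normal form have degree exactly $d$. A Boolean function $f$ on $\mathbb F_2^n$ is bent if for every nonzero $\mathbf{a}$ and $b\in\mathbb F_2$, $f(\mathbf{x}\oplus\mathbf{a})\oplus f(\mathbf{x})=b$ has $2^{n-1}$ solutions. -}

module Defs where

open import Data.Bool using (Bool; true; false; _xor_; _∧_; if_then_else_)
open import Data.Nat using (ℕ; zero; suc; _+_; _∸_; _^_)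
open import Data.Vec using (Vec; []; _∷_; replicate; zipWith; take; drop; map)
open import Data.List as List using (List; length; filter; concatMap; foldr)
open import Data.Product using (Σ; _×_; _,_)
open import Relation.Binary.PropositionalEquality using (_≡_; _≢_)
open import Relation.Nullary using (Dec; yes; no)
open import Data.Bool.Properties using (_≟_)
import Data.Vec.Properties as VP

-- F_2 is Bool (false = 0, true = 1, xor = addition, ∧ = multiplication).
-- F_2^n is Vec Bool n.  A Boolean function on F_2^n:
BoolFun : ℕ → Set
BoolFun n = Vec Bool n → Bool

allVecs : (n : ℕ) → List (Vec Bool n)
allVecs zero = [] List.∷ List.[]
allVecs (suc n) = concatMap (λ v → (false ∷ v) List.∷ (true ∷ v) List.∷ List.[]) (allVecs n)

zeroVec : (n : ℕ) → Vec Bool n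
zeroVec n = replicate n false

_⊕v_ : {n : ℕ} → Vec Bool n → Vec Bool n → Vec Bool n
_⊕v_ = zipWith _xor_

ip : {n : ℕ} → Vec Bool n → Vec Bool n → Bool
ip [] [] = false
ip (x ∷ xs) (z ∷ zs) = (x ∧ z) xor ip xs zs

wt : {n : ℕ} → Vec Bool n → ℕ
wt [] = 0
wt (false ∷ v) = wt v
wt (true ∷ v) = suc (wt v)

_⪯_ : {n : ℕ} → Vec Bool n → Vec Bool n → Bool
[] ⪯ [] = true
(true ∷ v) ⪯ (false ∷ u) = false
(_ ∷ v) ⪯ (_ ∷ u) = v ⪯ u

xorList : List Bool → Bool
xorList = foldr _xor_ false

-- ANF coefficient of the monomial x^u:  a_u = XOR_{v ⪯ u} f(v)  (binary Moebius transform)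
anfCoeff : {n : ℕ} → BoolFun n → Vec Bool n → Bool
anfCoeff {n} f u = xorList (List.map (λ v → (v ⪯ u) ∧ f v) (allVecs n))

Homogeneous : {n : ℕ} → ℕ → BoolFun n → Set
Homogeneous {n} d f = (u : Vec Bool n) → anfCoeff f u ≡ true → wt u ≡ d

countSol : {n : ℕ} → BoolFun n → Vec Bool n → Bool → ℕ
countSol {n} f a b =
  length (filter (λ x → (f (x ⊕v a) xor f x) ≟ b) (allVecs n))

-- bent (derivative-balance definition from the paper)
Bent : {n : ℕ} → BoolFun n → Set
Bent {n} f = (a : Vec Bool n) → a ≢ zeroVec n → (b : Bool) → countSol f a b ≡ 2 ^ (n ∸ 1)

HomBent : {n : ℕ} → ℕ → BoolFun n → Set
HomBent d f = Homogeneous d f × Bent f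

-- n×n binary matrices, given as a vector of rows
Matrix : ℕ → Set
Matrix n = Vec (Vec Bool n) n

vecMat : {k n : ℕ} → Vec Bool k → Vec (Vec Bool n) k → Vec Bool n
vecMat {n = n} [] [] = zeroVec n
vecMat (z ∷ zs) (r ∷ rs) = (if z then r else zeroVec _) ⊕v vecMat zs rs

_·M_ : {n : ℕ} → Matrix n → Matrix n → Matrix n
A ·M B = map (λ r → vecMat r B) A

identity : (n : ℕ) → Matrix n
identity zero = []
identity (suc n) = (true ∷ zeroVec n) ∷ map (false ∷_) (identity n)

Invertible : {n : ℕ} → Matrix n → Set
Invertible {n} T = Σ (Matrix n) (λ S → (T ·M S ≡ identity n) × (S ·M T ≡ identity n))

-- Maiorana–McFarland function h_{π,ψ}(x,y) = <x,π(y)>_m ⊕ ψ(y) on F_2^{2m} = F_2^{m+m},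
-- where (x,y) is the concatenation (first m coordinates x, last m coordinates y).
hMM : (m : ℕ) → (Vec Bool m → Vec Bool m) → (Vec Bool m → Bool) → BoolFun (m + m)
hMM m π ψ w = ip (take m w) (π (drop m w)) xor ψ (drop m w)

hMMT : (m : ℕ) → (Vec Bool m → Vec Bool m) → (Vec Bool m → Bool) → Matrix (m + m) → BoolFun (m + m)
hMMT m π ψ T z = hMM m π ψ (vecMat z T)

Omega : (m d : ℕ) → (Vec Bool m → Vec Bool m) → (Vec Bool m → Bool) → Matrix (m + m)
      → (Vec Bool m → Bool) → Set
Omega m d π φ T ω = HomBent d (hMMT m π (λ y → φ y xor ω y) T)

IsSubspace : (m : ℕ) → ((Vec Bool m → Bool) → Set) → Set
IsSubspace m P =
  P (λ _ → false)
  × ((ω₁ ω₂ : Vec Bool m → Bool) → P ω₁ → P ω₂ → P (λ y → ω₁ y xor ω₂ y))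
  × ((c : Bool) (ω : Vec Bool m → Bool) → P ω → P (λ y → c ∧ ω y))

-- Writing L z for the y-part of z T, the function h_{π,φ⊕ω}(z T) equals h_{π,φ}(z T) ⊕ ω(L z).
-- ANF coefficients are F₂-linear in the function, so given that h_{π,φ}∘T is d-homogeneous,
-- h_{π,φ⊕ω}∘T is d-homogeneous iff ω∘L is, and the latter condition is linear in ω.
-- Bentness is automatic: for bijective π the derivative of h_{π,ψ} in direction (a₁, a₂) is,
-- on each fibre y = const, an affine function of x with slope π(y ⊕ a₂) ⊕ π(y) ≠ 0 when a₂ ≠ 0,
-- and is the balanced function ⟨a₁, π(y)⟩ when a₂ = 0; an invertible T preserves bentness.
module Submission where

open import Defs
open import Algebra.Bundles using (CommutativeRing)
open import Data.Bool using (Bool; true; false; not; _xor_; _∧_; if_then_else_)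
open import Data.Bool.Properties
  using (_≟_; xor-assoc; xor-same; xor-identityʳ; not-distribˡ-xor; ∧-distribˡ-xor; ∧-comm; ∧-zeroʳ; xor-∧-commutativeRing)
open import Data.Nat using (ℕ; zero; suc; _≤_; _+_; _*_; _∸_; _^_)
open import Data.Nat.Properties using (+-identityʳ; +-suc; +-assoc; *-assoc; ^-distribˡ-+-*; +-commutativeSemigroup)
open import Data.Vec using (Vec; []; _∷_; _++_; take; drop)
import Data.Vec as Vec
import Data.Vec.Properties as VecP
open import Data.List using (List; length; filter; concatMap)
import Data.List as List
open import Data.List.Membership.Propositional using (_∈_)
open import Data.List.Membership.Propositional.Properties using (∈-map⁺)
open import Data.List.Membership.Propositional.Properties.WithK using (unique∧set⇒bag)
open import Data.List.Relation.Unary.Any using (here; there)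
open import Data.List.Relation.Unary.All using (All)
import Data.List.Relation.Unary.All as All
open import Data.List.Relation.Unary.AllPairs using (AllPairs)
open import Data.List.Relation.Unary.Unique.Propositional using (Unique)
import Data.List.Relation.Unary.Unique.Propositional.Properties as Unique
open import Data.List.Relation.Binary.BagAndSetEquality using (∼bag⇒↭)
open import Data.List.Relation.Binary.Permutation.Propositional using (_↭_)
open import Data.List.Relation.Binary.Permutation.Propositional.Properties using (filter-↭; ↭-length)
import Data.List.Properties as ListP
open import Data.Product using (_×_; _,_; proj₁; proj₂)
open import Data.Empty using (⊥-elim)
open import Relation.Binary.PropositionalEquality
open import Relation.Nullary using (¬_; Dec; yes; no)
open import Function.Base using (_∘_)
open import Function.Bundles using (_⇔_; mk⇔; Equivalence)
open import Function.Definitions using (Bijective)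
open import Function.Consequences.Propositional
  using (inverseᵇ⇒bijective; strictlyInverseˡ⇒inverseˡ; strictlyInverseʳ⇒inverseʳ)
open import Algebra.Properties.CommutativeSemigroup (CommutativeRing.+-commutativeSemigroup xor-∧-commutativeRing)
  using () renaming (interchange to xor-interchange)
open import Algebra.Properties.CommutativeSemigroup +-commutativeSemigroup
  using () renaming (interchange to +-interchange)

open ≡-Reasoning

xor-cancelʳ : (a b : Bool) → (a xor b) xor b ≡ a
xor-cancelʳ a b = begin
  (a xor b) xor b  ≡⟨ xor-assoc a b b ⟩
  a xor (b xor b)  ≡⟨ cong (a xor_) (xor-same b) ⟩
  a xor false      ≡⟨ xor-identityʳ a ⟩
  a                ∎

xor-cancelˡ : (a b : Bool) → a xor (a xor b) ≡ b
xor-cancelˡ a b = trans (sym (xor-assoc a a b)) (cong (_xor b) (xor-same a))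

-- Linear algebra over F₂

⊕v-assoc : {n : ℕ} (u v w : Vec Bool n) → (u ⊕v v) ⊕v w ≡ u ⊕v (v ⊕v w)
⊕v-assoc = VecP.zipWith-assoc xor-assoc

⊕v-identityˡ : {n : ℕ} (v : Vec Bool n) → zeroVec n ⊕v v ≡ v
⊕v-identityˡ = VecP.zipWith-identityˡ (λ _ → refl)

⊕v-identityʳ : {n : ℕ} (v : Vec Bool n) → v ⊕v zeroVec n ≡ v
⊕v-identityʳ = VecP.zipWith-identityʳ xor-identityʳ

⊕v-self : {n : ℕ} (v : Vec Bool n) → v ⊕v v ≡ zeroVec n
⊕v-self []      = refl
⊕v-self (x ∷ v) = cong₂ _∷_ (xor-same x) (⊕v-self v)

⊕v-interchange : {n : ℕ} (a b c d : Vec Bool n) → (a ⊕v b) ⊕v (c ⊕v d) ≡ (a ⊕v c) ⊕v (b ⊕v d)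
⊕v-interchange []       []       []       []       = refl
⊕v-interchange (a ∷ as) (b ∷ bs) (c ∷ cs) (d ∷ ds) =
  cong₂ _∷_ (xor-interchange a b c d) (⊕v-interchange as bs cs ds)

⊕v-cancelˡ : {n : ℕ} (u v w : Vec Bool n) → u ⊕v v ≡ u ⊕v w → v ≡ w
⊕v-cancelˡ {n} u v w eq = begin
  v                    ≡⟨ sym (cancel v) ⟩
  u ⊕v (u ⊕v v)        ≡⟨ cong (u ⊕v_) eq ⟩
  u ⊕v (u ⊕v w)        ≡⟨ cancel w ⟩
  w                    ∎
  where
  cancel : (x : Vec Bool n) → u ⊕v (u ⊕v x) ≡ x
  cancel x = trans (sym (⊕v-assoc u u x)) (trans (cong (_⊕v x) (⊕v-self u)) (⊕v-identityˡ x))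

⊕v≡zero⇒≡ : {n : ℕ} (u v : Vec Bool n) → u ⊕v v ≡ zeroVec n → u ≡ v
⊕v≡zero⇒≡ u v eq = sym (⊕v-cancelˡ u v u (trans eq (sym (⊕v-self u))))

take-drop-++ : {A : Set} {m n : ℕ} (x : Vec A m) (y : Vec A n) → take m (x ++ y) ≡ x × drop m (x ++ y) ≡ y
take-drop-++ {m = m} x y = VecP.++-injective (take m (x ++ y)) x (VecP.take++drop≡id m (x ++ y))

zeroVec-++ : (m n : ℕ) → zeroVec m ++ zeroVec n ≡ zeroVec (m + n)
zeroVec-++ zero    n = refl
zeroVec-++ (suc m) n = cong (false ∷_) (zeroVec-++ m n)

scale-xor : {n : ℕ} (p q : Bool) (r : Vec Bool n) →
  (if p xor q then r else zeroVec n) ≡ (if p then r else zeroVec n) ⊕v (if q then r else zeroVec n)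
scale-xor true  true  r = sym (⊕v-self r)
scale-xor true  false r = sym (⊕v-identityʳ r)
scale-xor false true  r = sym (⊕v-identityˡ r)
scale-xor false false r = sym (⊕v-identityˡ _)

vecMat-⊕v : {k n : ℕ} (z a : Vec Bool k) (R : Vec (Vec Bool n) k) →
  vecMat (z ⊕v a) R ≡ vecMat z R ⊕v vecMat a R
vecMat-⊕v []       []       []       = sym (⊕v-identityˡ _)
vecMat-⊕v (z ∷ zs) (a ∷ as) (r ∷ rs) =
  trans (cong₂ _⊕v_ (scale-xor z a r) (vecMat-⊕v zs as rs)) (⊕v-interchange _ _ _ _)

vecMat-zero : {k n : ℕ} (R : Vec (Vec Bool n) k) → vecMat (zeroVec k) R ≡ zeroVec n
vecMat-zero []       = refl
vecMat-zero (r ∷ rs) = trans (cong (zeroVec _ ⊕v_) (vecMat-zero rs)) (⊕v-identityˡ _)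

vecMat-map-false∷ : {k n : ℕ} (z : Vec Bool k) (R : Vec (Vec Bool n) k) →
  vecMat z (Vec.map (false ∷_) R) ≡ false ∷ vecMat z R
vecMat-map-false∷ []         []      = refl
vecMat-map-false∷ (true ∷ z)  (r ∷ R) rewrite vecMat-map-false∷ z R = refl
vecMat-map-false∷ (false ∷ z) (r ∷ R) rewrite vecMat-map-false∷ z R = refl

vecMat-identity : (n : ℕ) (z : Vec Bool n) → vecMat z (identity n) ≡ z
vecMat-identity zero    []      = refl
vecMat-identity (suc n) (x ∷ z)
  rewrite vecMat-map-false∷ z (identity n) | vecMat-identity n z with x
... | true  = cong (true ∷_) (⊕v-identityˡ z)
... | false = cong (false ∷_) (⊕v-identityˡ z)

vecMat-·M : {k n : ℕ} (z : Vec Bool k) (T : Vec (Vec Bool n) k) (S : Matrix n) →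
  vecMat (vecMat z T) S ≡ vecMat z (Vec.map (λ r → vecMat r S) T)
vecMat-·M []          []      S = vecMat-zero S
vecMat-·M (true ∷ z)  (r ∷ T) S =
  trans (vecMat-⊕v r (vecMat z T) S) (cong (vecMat r S ⊕v_) (vecMat-·M z T S))
vecMat-·M (false ∷ z) (r ∷ T) S =
  trans (vecMat-⊕v (zeroVec _) (vecMat z T) S) (cong₂ _⊕v_ (vecMat-zero S) (vecMat-·M z T S))

vecMat-bijective : {n : ℕ} (T : Matrix n) → Invertible T → Bijective _≡_ _≡_ (λ z → vecMat z T)
vecMat-bijective {n} T (S , TS≡I , ST≡I) =
  inverseᵇ⇒bijective (strictlyInverseˡ⇒inverseˡ {f⁻¹ = _· S} (_· T) (undo S T ST≡I)
                     , strictlyInverseʳ⇒inverseʳ (_· T) (undo T S TS≡I))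
  where
  _·_ : Vec Bool n → Matrix n → Vec Bool n
  z · A = vecMat z A
  undo : (A B : Matrix n) → A ·M B ≡ identity n → (z : Vec Bool n) → vecMat (vecMat z A) B ≡ z
  undo A B AB≡I z = trans (vecMat-·M z A B) (trans (cong (vecMat z) AB≡I) (vecMat-identity n z))

ip-comm : {n : ℕ} (x y : Vec Bool n) → ip x y ≡ ip y x
ip-comm []       []       = refl
ip-comm (x ∷ xs) (y ∷ ys) = cong₂ _xor_ (∧-comm x y) (ip-comm xs ys)

ip-⊕vʳ : {n : ℕ} (x p q : Vec Bool n) → ip x (p ⊕v q) ≡ ip x p xor ip x q
ip-⊕vʳ []       []       []       = refl
ip-⊕vʳ (x ∷ xs) (p ∷ ps) (q ∷ qs) = begin
  (x ∧ (p xor q)) xor ip xs (ps ⊕v qs)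
    ≡⟨ cong₂ _xor_ (∧-distribˡ-xor x p q) (ip-⊕vʳ xs ps qs) ⟩
  ((x ∧ p) xor (x ∧ q)) xor (ip xs ps xor ip xs qs)
    ≡⟨ xor-interchange (x ∧ p) (x ∧ q) (ip xs ps) (ip xs qs) ⟩
  ((x ∧ p) xor ip xs ps) xor ((x ∧ q) xor ip xs qs) ∎

ip-⊕vˡ : {n : ℕ} (x a p : Vec Bool n) → ip (x ⊕v a) p ≡ ip x p xor ip a p
ip-⊕vˡ x a p = begin
  ip (x ⊕v a) p       ≡⟨ ip-comm (x ⊕v a) p ⟩
  ip p (x ⊕v a)       ≡⟨ ip-⊕vʳ p x a ⟩
  ip p x xor ip p a   ≡⟨ cong₂ _xor_ (ip-comm p x) (ip-comm p a) ⟩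
  ip x p xor ip a p   ∎

ip-zeroʳ : {n : ℕ} (x : Vec Bool n) → ip x (zeroVec n) ≡ false
ip-zeroʳ []       = refl
ip-zeroʳ (x ∷ xs) = cong₂ _xor_ (∧-zeroʳ x) (ip-zeroʳ xs)

-- Counting

countL : {A : Set} → List A → (A → Bool) → Bool → ℕ
countL xs g b = length (filter (λ x → g x ≟ b) xs)

count : (n : ℕ) → BoolFun n → Bool → ℕ
count n = countL (allVecs n)

derivative : {n : ℕ} → BoolFun n → Vec Bool n → BoolFun n
derivative f a x = f (x ⊕v a) xor f x

oneIf : {P : Set} → Dec P → ℕ
oneIf (yes _) = 1
oneIf (no _)  = 0

countL-∷ : {A : Set} (x : A) (xs : List A) (g : A → Bool) (b : Bool) →
  countL (x List.∷ xs) g b ≡ oneIf (g x ≟ b) + countL xs g b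
countL-∷ x xs g b with g x ≟ b
... | yes _ = refl
... | no _  = refl

countL-cong : {A : Set} (xs : List A) {g h : A → Bool} (b : Bool) → (∀ x → g x ≡ h x) →
  countL xs g b ≡ countL xs h b
countL-cong xs b g≗h =
  cong length (ListP.filter-≐ _ _ ((λ {x} p → trans (sym (g≗h x)) p) , (λ {x} p → trans (g≗h x) p)) xs)

count-cong : (n : ℕ) {g h : BoolFun n} (b : Bool) → (∀ x → g x ≡ h x) → count n g b ≡ count n h b
count-cong n = countL-cong (allVecs n)

countL-complement : {A : Set} (xs : List A) (g : A → Bool) (b : Bool) →
  countL xs g b + countL xs (λ x → not (g x)) b ≡ length xs
countL-complement List.[]       g b = refl
countL-complement (x List.∷ xs) g b = begin
  countL (x List.∷ xs) g b + countL (x List.∷ xs) (λ x → not (g x)) b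
    ≡⟨ cong₂ _+_ (countL-∷ x xs g b) (countL-∷ x xs _ b) ⟩
  (oneIf (g x ≟ b) + countL xs g b) + (oneIf (not (g x) ≟ b) + countL xs _ b)
    ≡⟨ +-interchange (oneIf (g x ≟ b)) _ _ _ ⟩
  (oneIf (g x ≟ b) + oneIf (not (g x) ≟ b)) + (countL xs g b + countL xs _ b)
    ≡⟨ cong₂ _+_ (exactlyOne (g x) b) (countL-complement xs g b) ⟩
  suc (length xs) ∎
  where
  exactlyOne : (c b : Bool) → oneIf (c ≟ b) + oneIf (not c ≟ b) ≡ 1
  exactlyOne false false = refl
  exactlyOne false true  = refl
  exactlyOne true  false = refl
  exactlyOne true  true  = refl

countL-map : {A : Set} (σ : A → A) (xs : List A) (g : A → Bool) (b : Bool) →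
  countL (List.map σ xs) g b ≡ countL xs (g ∘ σ) b
countL-map σ List.[]       g b = refl
countL-map σ (x List.∷ xs) g b with g (σ x) ≟ b
... | yes _ = cong suc (countL-map σ xs g b)
... | no _  = countL-map σ xs g b

consBoth : {n : ℕ} → Vec Bool n → List (Vec Bool (suc n))
consBoth v = (false ∷ v) List.∷ (true ∷ v) List.∷ List.[]

countL-consBoth : {n : ℕ} (xs : List (Vec Bool n)) (g : BoolFun (suc n)) (b : Bool) →
  countL (concatMap consBoth xs) g b ≡ countL xs (λ v → g (false ∷ v)) b + countL xs (λ v → g (true ∷ v)) b
countL-consBoth List.[]       g b = refl
countL-consBoth (x List.∷ xs) g b = begin
  countL ((false ∷ x) List.∷ (true ∷ x) List.∷ concatMap consBoth xs) g b
    ≡⟨ countL-∷ (false ∷ x) _ g b ⟩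
  i₀ + countL ((true ∷ x) List.∷ concatMap consBoth xs) g b
    ≡⟨ cong (i₀ +_) (countL-∷ (true ∷ x) _ g b) ⟩
  i₀ + (i₁ + countL (concatMap consBoth xs) g b)
    ≡⟨ cong (λ t → i₀ + (i₁ + t)) (countL-consBoth xs g b) ⟩
  i₀ + (i₁ + (countL xs g₀ b + countL xs g₁ b))
    ≡⟨ sym (+-assoc i₀ i₁ _) ⟩
  (i₀ + i₁) + (countL xs g₀ b + countL xs g₁ b)
    ≡⟨ +-interchange i₀ (countL xs g₀ b) i₁ _ ⟨
  (i₀ + countL xs g₀ b) + (i₁ + countL xs g₁ b)
    ≡⟨ cong₂ _+_ (countL-∷ x xs g₀ b) (countL-∷ x xs g₁ b) ⟨
  countL (x List.∷ xs) g₀ b + countL (x List.∷ xs) g₁ b ∎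
  where
  g₀ g₁ : BoolFun _
  g₀ v = g (false ∷ v)
  g₁ v = g (true ∷ v)
  i₀ i₁ : ℕ
  i₀ = oneIf (g₀ x ≟ b)
  i₁ = oneIf (g₁ x ≟ b)

count-suc : (n : ℕ) (g : BoolFun (suc n)) (b : Bool) →
  count (suc n) g b ≡ count n (λ v → g (false ∷ v)) b + count n (λ v → g (true ∷ v)) b
count-suc n = countL-consBoth (allVecs n)

length-allVecs : (n : ℕ) → length (allVecs n) ≡ 2 ^ n
length-allVecs zero    = refl
length-allVecs (suc n) = begin
  length (concatMap consBoth (allVecs n))  ≡⟨ doubles (allVecs n) ⟩
  length (allVecs n) + length (allVecs n)  ≡⟨ cong₂ _+_ (length-allVecs n) (length-allVecs n) ⟩
  2 ^ n + 2 ^ n                            ≡⟨ cong (2 ^ n +_) (+-identityʳ (2 ^ n)) ⟨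
  2 ^ suc n                                ∎
  where
  doubles : (xs : List (Vec Bool n)) → length (concatMap consBoth xs) ≡ length xs + length xs
  doubles List.[]       = refl
  doubles (x List.∷ xs) = cong suc (trans (cong suc (doubles xs)) (sym (+-suc _ _)))

count-complement : (n : ℕ) (g : BoolFun n) (b : Bool) → count n g b + count n (λ x → not (g x)) b ≡ 2 ^ n
count-complement n g b = trans (countL-complement (allVecs n) g b) (length-allVecs n)

allVecs-unique : (n : ℕ) → Unique (allVecs n)
allVecs-unique zero    = All.[] AllPairs.∷ AllPairs.[]
allVecs-unique (suc n) = consBoth-unique (allVecs n) (allVecs-unique n)
  where
  heads-differ : (c : Bool) {v : Vec Bool n} {vs : List (Vec Bool n)} →
    All (λ w → ¬ v ≡ w) vs → All (λ w → ¬ (c ∷ v) ≡ w) (concatMap consBoth vs)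
  heads-differ c All.[]         = All.[]
  heads-differ c (v≢w All.∷ ps) = (λ { refl → v≢w refl }) All.∷ ((λ { refl → v≢w refl }) All.∷ heads-differ c ps)
  consBoth-unique : (xs : List (Vec Bool n)) → Unique xs → Unique (concatMap consBoth xs)
  consBoth-unique List.[]       AllPairs.[]        = AllPairs.[]
  consBoth-unique (v List.∷ vs) (v∉vs AllPairs.∷ u) =
    ((λ ()) All.∷ heads-differ false v∉vs) AllPairs.∷ (heads-differ true v∉vs AllPairs.∷ consBoth-unique vs u)

∈-allVecs : (n : ℕ) (v : Vec Bool n) → v ∈ allVecs n
∈-allVecs zero    []      = here refl
∈-allVecs (suc n) (c ∷ v) = ∈-consBoth c (∈-allVecs n v)
  where
  ∈-consBoth : (c : Bool) {xs : List (Vec Bool n)} → v ∈ xs → (c ∷ v) ∈ concatMap consBoth xs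
  ∈-consBoth false (here refl) = here refl
  ∈-consBoth true  (here refl) = there (here refl)
  ∈-consBoth c     (there p)   = there (there (∈-consBoth c p))

-- A bijection permutes the duplicate-free complete list allVecs n.
count-∘-bijection : (n : ℕ) (σ : Vec Bool n → Vec Bool n) → Bijective _≡_ _≡_ σ →
  (g : BoolFun n) (b : Bool) → count n (g ∘ σ) b ≡ count n g b
count-∘-bijection n σ (σ-inj , σ-surj) g b =
  trans (sym (countL-map σ (allVecs n) g b)) (↭-length (filter-↭ (λ x → g x ≟ b) σ-permutes))
  where
  σ-permutes : List.map σ (allVecs n) ↭ allVecs n
  σ-permutes = ∼bag⇒↭ (unique∧set⇒bag (Unique.map⁺ σ-inj (allVecs-unique n)) (allVecs-unique n)
    (λ {y} → mk⇔ (λ _ → ∈-allVecs n y)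
      (λ _ → subst (_∈ List.map σ (allVecs n)) (proj₂ (σ-surj y) refl) (∈-map⁺ σ (∈-allVecs n _)))))

count-constant-fibres : (k m : ℕ) (Q : BoolFun (k + m)) (b : Bool) (c : ℕ) →
  (∀ y → count m (λ x → Q (y ++ x)) b ≡ c) → count (k + m) Q b ≡ 2 ^ k * c
count-constant-fibres zero    m Q b c fibre = trans (fibre []) (sym (+-identityʳ c))
count-constant-fibres (suc k) m Q b c fibre = begin
  count (suc (k + m)) Q b
    ≡⟨ count-suc (k + m) Q b ⟩
  count (k + m) (λ v → Q (false ∷ v)) b + count (k + m) (λ v → Q (true ∷ v)) b
    ≡⟨ cong₂ _+_ (count-constant-fibres k m _ b c (fibre ∘ (false ∷_)))
                 (count-constant-fibres k m _ b c (fibre ∘ (true ∷_))) ⟩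
  2 ^ k * c + 2 ^ k * c
    ≡⟨ cong (2 ^ k * c +_) (+-identityʳ (2 ^ k * c)) ⟨
  2 * (2 ^ k * c)
    ≡⟨ *-assoc 2 (2 ^ k) c ⟨
  2 ^ suc k * c ∎

count-affine : (n : ℕ) (a : Vec Bool n) → a ≢ zeroVec n → (e b : Bool) →
  count n (λ x → ip x a xor e) b ≡ 2 ^ (n ∸ 1)
count-affine zero          []         a≢0 e b = ⊥-elim (a≢0 refl)
count-affine (suc n)       (true ∷ a) _   e b = begin
  count (suc n) (λ x → ip x (true ∷ a) xor e) b
    ≡⟨ count-suc n _ b ⟩
  count n (λ v → ip v a xor e) b + count n (λ v → not (ip v a) xor e) b
    ≡⟨ cong (count n _ b +_) (count-cong n b (λ v → sym (not-distribˡ-xor (ip v a) e))) ⟩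
  count n (λ v → ip v a xor e) b + count n (λ v → not (ip v a xor e)) b
    ≡⟨ count-complement n _ b ⟩
  2 ^ n ∎
count-affine (suc zero)    (false ∷ []) a≢0 e b = ⊥-elim (a≢0 refl)
count-affine (suc (suc n)) (false ∷ a)  a≢0 e b = begin
  count (suc (suc n)) (λ x → ip x (false ∷ a) xor e) b
    ≡⟨ count-suc (suc n) _ b ⟩
  count (suc n) (λ v → ip v a xor e) b + count (suc n) (λ v → ip v a xor e) b
    ≡⟨ cong₂ _+_ half half ⟩
  2 ^ n + 2 ^ n
    ≡⟨ cong (2 ^ n +_) (+-identityʳ (2 ^ n)) ⟨
  2 ^ suc n ∎
  where
  half : count (suc n) (λ v → ip v a xor e) b ≡ 2 ^ n
  half = count-affine (suc n) a (a≢0 ∘ cong (false ∷_)) e b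

-- Bentness

2^m*2^[m∸1]≡2^[m+m∸1] : (m : ℕ) → 2 ^ m * 2 ^ (m ∸ 1) ≡ 2 ^ (m + m ∸ 1)
2^m*2^[m∸1]≡2^[m+m∸1] zero    = refl
2^m*2^[m∸1]≡2^[m+m∸1] (suc m) = trans (sym (^-distribˡ-+-* 2 (suc m) m)) (cong (2 ^_) (sym (+-suc m m)))

module MaioranaMcFarland {m : ℕ} (π : Vec Bool m → Vec Bool m) (π-bij : Bijective _≡_ _≡_ π)
                         (ψ : Vec Bool m → Bool) where

  h : BoolFun (m + m)
  h = hMM m π ψ

  h-++ : (x y : Vec Bool m) → h (x ++ y) ≡ ip x (π y) xor ψ y
  h-++ x y rewrite proj₁ (take-drop-++ x y) | proj₂ (take-drop-++ x y) = refl

  derivative-++ : (a₁ a₂ x y : Vec Bool m) → derivative h (a₁ ++ a₂) (x ++ y) ≡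
    ip x (π (y ⊕v a₂) ⊕v π y) xor ((ip a₁ (π (y ⊕v a₂)) xor ψ (y ⊕v a₂)) xor ψ y)
  derivative-++ a₁ a₂ x y = begin
    h ((x ++ y) ⊕v (a₁ ++ a₂)) xor h (x ++ y)
      ≡⟨ cong₂ _xor_ (trans (cong h (VecP.zipWith-++ _xor_ x y a₁ a₂)) (h-++ (x ⊕v a₁) (y ⊕v a₂))) (h-++ x y) ⟩
    (ip (x ⊕v a₁) p′ xor ψ′) xor (ip x p xor ψ y)
      ≡⟨ cong (λ t → (t xor ψ′) xor (ip x p xor ψ y)) (ip-⊕vˡ x a₁ p′) ⟩
    ((ip x p′ xor ip a₁ p′) xor ψ′) xor (ip x p xor ψ y)
      ≡⟨ cong (_xor (ip x p xor ψ y)) (xor-assoc (ip x p′) _ ψ′) ⟩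
    (ip x p′ xor (ip a₁ p′ xor ψ′)) xor (ip x p xor ψ y)
      ≡⟨ xor-interchange (ip x p′) _ (ip x p) (ψ y) ⟩
    (ip x p′ xor ip x p) xor ((ip a₁ p′ xor ψ′) xor ψ y)
      ≡⟨ cong (_xor ((ip a₁ p′ xor ψ′) xor ψ y)) (ip-⊕vʳ x p′ p) ⟨
    ip x (p′ ⊕v p) xor ((ip a₁ p′ xor ψ′) xor ψ y) ∎
    where
    p p′ : Vec Bool m
    p  = π y
    p′ = π (y ⊕v a₂)
    ψ′ : Bool
    ψ′ = ψ (y ⊕v a₂)

  swapHalves : Vec Bool (m + m) → Vec Bool (m + m)
  swapHalves v = drop m v ++ take m v

  swapHalves-++ : (y x : Vec Bool m) → swapHalves (y ++ x) ≡ x ++ y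
  swapHalves-++ y x = cong₂ _++_ (proj₂ (take-drop-++ y x)) (proj₁ (take-drop-++ y x))

  swapHalves-bijective : Bijective _≡_ _≡_ swapHalves
  swapHalves-bijective =
    inverseᵇ⇒bijective (strictlyInverseˡ⇒inverseˡ swapHalves involutive , strictlyInverseʳ⇒inverseʳ swapHalves involutive)
    where
    involutive : (v : Vec Bool (m + m)) → swapHalves (swapHalves v) ≡ v
    involutive v = trans (swapHalves-++ (drop m v) (take m v)) (VecP.take++drop≡id m v)

  -- For a₂ ≠ 0 the derivative is a non-constant affine function of x on every fibre y = const.
  count-derivative-shifted : (a₁ a₂ : Vec Bool m) → a₂ ≢ zeroVec m → (b : Bool) →
    count (m + m) (derivative h (a₁ ++ a₂)) b ≡ 2 ^ m * 2 ^ (m ∸ 1)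
  count-derivative-shifted a₁ a₂ a₂≢0 b = begin
    count (m + m) (derivative h (a₁ ++ a₂)) b
      ≡⟨ count-∘-bijection (m + m) swapHalves swapHalves-bijective _ b ⟨
    count (m + m) (derivative h (a₁ ++ a₂) ∘ swapHalves) b
      ≡⟨ count-constant-fibres m m _ b _ fibre ⟩
    2 ^ m * 2 ^ (m ∸ 1) ∎
    where
    fibre : (y : Vec Bool m) → count m (λ x → derivative h (a₁ ++ a₂) (swapHalves (y ++ x))) b ≡ 2 ^ (m ∸ 1)
    fibre y = trans (count-cong m b (λ x → trans (cong (derivative h (a₁ ++ a₂)) (swapHalves-++ y x))
                                                (derivative-++ a₁ a₂ x y)))
                    (count-affine m (π (y ⊕v a₂) ⊕v π y) slope≢0 _ b)
      where
      slope≢0 : π (y ⊕v a₂) ⊕v π y ≢ zeroVec m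
      slope≢0 eq = a₂≢0 (⊕v-cancelˡ y a₂ (zeroVec m)
        (trans (proj₁ π-bij (⊕v≡zero⇒≡ _ _ eq)) (sym (⊕v-identityʳ y))))

  -- For a₂ = 0 the derivative is x-independent: (x, y) ↦ ⟨a₁, π y⟩, balanced since π is a bijection.
  count-derivative-unshifted : (a₁ : Vec Bool m) → a₁ ≢ zeroVec m → (b : Bool) →
    count (m + m) (derivative h (a₁ ++ zeroVec m)) b ≡ 2 ^ m * 2 ^ (m ∸ 1)
  count-derivative-unshifted a₁ a₁≢0 b = count-constant-fibres m m _ b _ λ x → begin
    count m (λ y → derivative h (a₁ ++ zeroVec m) (x ++ y)) b  ≡⟨ count-cong m b (derivative≡ x) ⟩
    count m (ip a₁ ∘ π) b                                     ≡⟨ count-∘-bijection m π π-bij (ip a₁) b ⟩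
    count m (ip a₁) b                                         ≡⟨ count-cong m b linear ⟩
    count m (λ y → ip y a₁ xor false) b                       ≡⟨ count-affine m a₁ a₁≢0 false b ⟩
    2 ^ (m ∸ 1)                                               ∎
    where
    linear : (y : Vec Bool m) → ip a₁ y ≡ ip y a₁ xor false
    linear y = trans (ip-comm a₁ y) (sym (xor-identityʳ _))
    derivative≡ : (x y : Vec Bool m) → derivative h (a₁ ++ zeroVec m) (x ++ y) ≡ ip a₁ (π y)
    derivative≡ x y = begin
      derivative h (a₁ ++ zeroVec m) (x ++ y)
        ≡⟨ derivative-++ a₁ (zeroVec m) x y ⟩
      ip x (π (y ⊕v zeroVec m) ⊕v π y) xor ((ip a₁ (π (y ⊕v zeroVec m)) xor ψ (y ⊕v zeroVec m)) xor ψ y)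
        ≡⟨ cong (λ w → ip x (π w ⊕v π y) xor ((ip a₁ (π w) xor ψ w) xor ψ y)) (⊕v-identityʳ y) ⟩
      ip x (π y ⊕v π y) xor ((ip a₁ (π y) xor ψ y) xor ψ y)
        ≡⟨ cong₂ _xor_ (trans (cong (ip x) (⊕v-self (π y))) (ip-zeroʳ x)) (xor-cancelʳ (ip a₁ (π y)) (ψ y)) ⟩
      ip a₁ (π y) ∎

  hMM-bent : Bent h
  hMM-bent a a≢0 b = begin
    countSol h a b
      ≡⟨ cong (λ w → countSol h w b) (VecP.take++drop≡id m a) ⟨
    count (m + m) (derivative h (a₁ ++ a₂)) b
      ≡⟨ by-cases (VecP.≡-dec _≟_ a₂ (zeroVec m)) ⟩
    2 ^ m * 2 ^ (m ∸ 1)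
      ≡⟨ 2^m*2^[m∸1]≡2^[m+m∸1] m ⟩
    2 ^ (m + m ∸ 1) ∎
    where
    a₁ a₂ : Vec Bool m
    a₁ = take m a
    a₂ = drop m a
    by-cases : Dec (a₂ ≡ zeroVec m) → count (m + m) (derivative h (a₁ ++ a₂)) b ≡ 2 ^ m * 2 ^ (m ∸ 1)
    by-cases (no a₂≢0)   = count-derivative-shifted a₁ a₂ a₂≢0 b
    by-cases (yes a₂≡0) rewrite a₂≡0 = count-derivative-unshifted a₁ a₁≢0 b
      where
      a₁≢0 : a₁ ≢ zeroVec m
      a₁≢0 a₁≡0 = a≢0 (begin
        a                         ≡⟨ VecP.take++drop≡id m a ⟨
        a₁ ++ a₂                  ≡⟨ cong₂ _++_ a₁≡0 a₂≡0 ⟩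
        zeroVec m ++ zeroVec m    ≡⟨ zeroVec-++ m m ⟩
        zeroVec (m + m)           ∎)

bent-∘-additive-bijection : {n : ℕ} (f : BoolFun n) (σ : Vec Bool n → Vec Bool n) → Bijective _≡_ _≡_ σ →
  (∀ z a → σ (z ⊕v a) ≡ σ z ⊕v σ a) → Bent f → Bent (f ∘ σ)
bent-∘-additive-bijection {n} f σ σ-bij σ-additive f-bent a a≢0 b = begin
  count n (λ z → f (σ (z ⊕v a)) xor f (σ z)) b
    ≡⟨ count-cong n b (λ z → cong (λ w → f w xor f (σ z)) (σ-additive z a)) ⟩
  count n (derivative f (σ a) ∘ σ) b
    ≡⟨ count-∘-bijection n σ σ-bij (derivative f (σ a)) b ⟩
  countSol f (σ a) b
    ≡⟨ f-bent (σ a) σa≢0 b ⟩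
  2 ^ (n ∸ 1) ∎
  where
  σ-zero : σ (zeroVec n) ≡ zeroVec n
  σ-zero = begin
    σ (zeroVec n)                      ≡⟨ cong σ (⊕v-self (zeroVec n)) ⟨
    σ (zeroVec n ⊕v zeroVec n)         ≡⟨ σ-additive (zeroVec n) (zeroVec n) ⟩
    σ (zeroVec n) ⊕v σ (zeroVec n)     ≡⟨ ⊕v-self (σ (zeroVec n)) ⟩
    zeroVec n                          ∎
  σa≢0 : σ a ≢ zeroVec n
  σa≢0 σa≡0 = a≢0 (proj₁ σ-bij (trans σa≡0 (sym σ-zero)))

hMMT-bent : (m : ℕ) (π : Vec Bool m → Vec Bool m) → Bijective _≡_ _≡_ π → (ψ : Vec Bool m → Bool) →
  (T : Matrix (m + m)) → Invertible T → Bent (hMMT m π ψ T)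
hMMT-bent m π π-bij ψ T T-inv =
  bent-∘-additive-bijection (hMM m π ψ) (λ z → vecMat z T) (vecMat-bijective T T-inv)
    (λ z a → vecMat-⊕v z a T) (MaioranaMcFarland.hMM-bent π π-bij ψ)

-- Homogeneity

anfCoeff-xor : {n : ℕ} (f g : BoolFun n) (u : Vec Bool n) →
  anfCoeff (λ v → f v xor g v) u ≡ anfCoeff f u xor anfCoeff g u
anfCoeff-xor {n} f g u = go (allVecs n)
  where
  go : (xs : List (Vec Bool n)) →
    xorList (List.map (λ v → (v ⪯ u) ∧ (f v xor g v)) xs) ≡
    xorList (List.map (λ v → (v ⪯ u) ∧ f v) xs) xor xorList (List.map (λ v → (v ⪯ u) ∧ g v) xs)
  go List.[]       = refl
  go (v List.∷ vs) = trans (cong₂ _xor_ (∧-distribˡ-xor (v ⪯ u) (f v) (g v)) (go vs))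
                           (xor-interchange ((v ⪯ u) ∧ f v) _ _ _)

anfCoeff-false : {n : ℕ} (u : Vec Bool n) → anfCoeff {n} (λ _ → false) u ≡ false
anfCoeff-false {n} u = go (allVecs n)
  where
  go : (xs : List (Vec Bool n)) → xorList (List.map (λ v → (v ⪯ u) ∧ false) xs) ≡ false
  go List.[]       = refl
  go (v List.∷ vs) = cong₂ _xor_ (∧-zeroʳ (v ⪯ u)) (go vs)

anfCoeff-cong : {n : ℕ} {f g : BoolFun n} → (∀ v → f v ≡ g v) → (u : Vec Bool n) → anfCoeff f u ≡ anfCoeff g u
anfCoeff-cong {n} f≗g u = cong xorList (ListP.map-cong (λ v → cong ((v ⪯ u) ∧_) (f≗g v)) (allVecs n))

homogeneous-false : {n : ℕ} (d : ℕ) → Homogeneous {n} d (λ _ → false)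
homogeneous-false d u coeff≡true with () ← trans (sym (anfCoeff-false u)) coeff≡true

homogeneous-xor : {n : ℕ} (d : ℕ) {f g : BoolFun n} → Homogeneous d f → Homogeneous d g →
  Homogeneous d (λ v → f v xor g v)
homogeneous-xor d {f} {g} f-hom g-hom u coeff≡true
  with anfCoeff f u | anfCoeff g u | anfCoeff-xor f g u | f-hom u | g-hom u
... | true  | _    | _ | f-hom-u | _       = f-hom-u refl
... | false | true | _ | _       | g-hom-u = g-hom-u refl
... | false | false | eq | _     | _       with () ← trans (sym eq) coeff≡true

homogeneous-cong : {n : ℕ} (d : ℕ) {f g : BoolFun n} → (∀ v → f v ≡ g v) → Homogeneous d f → Homogeneous d g
homogeneous-cong d f≗g f-hom u coeff≡true = f-hom u (trans (anfCoeff-cong f≗g u) coeff≡true)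

homogeneous-cancelˡ : {n : ℕ} (d : ℕ) {f g : BoolFun n} → Homogeneous d f → Homogeneous d (λ v → f v xor g v) →
  Homogeneous d g
homogeneous-cancelˡ d {f} {g} f-hom fg-hom =
  homogeneous-cong d (λ v → xor-cancelˡ (f v) (g v)) (homogeneous-xor d f-hom fg-hom)

pullback-homogeneous-isSubspace : {n : ℕ} (m d : ℕ) (L : Vec Bool n → Vec Bool m) →
  IsSubspace m (λ ω → Homogeneous d (ω ∘ L))
pullback-homogeneous-isSubspace m d L =
  homogeneous-false d , (λ _ _ → homogeneous-xor d) , scale
  where
  scale : (c : Bool) (ω : Vec Bool m → Bool) → Homogeneous d (ω ∘ L) → Homogeneous d (λ z → c ∧ ω (L z))
  scale false ω _     = homogeneous-false d
  scale true  ω ω-hom = ω-hom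

isSubspace-resp-⇔ : (m : ℕ) {P Q : (Vec Bool m → Bool) → Set} → (∀ ω → P ω ⇔ Q ω) →
  IsSubspace m P → IsSubspace m Q
isSubspace-resp-⇔ m P⇔Q (P0 , P+ , P·) =
  to _ P0 , (λ ω₁ ω₂ q₁ q₂ → to _ (P+ ω₁ ω₂ (from _ q₁) (from _ q₂))) , (λ c ω q → to _ (P· c ω (from _ q)))
  where
  to   = λ ω → Equivalence.to (P⇔Q ω)
  from = λ ω → Equivalence.from (P⇔Q ω)

mainTheorem5 : (m d : ℕ) → 1 ≤ m
    → (π : Vec Bool m → Vec Bool m) → Bijective _≡_ _≡_ π
    → (φ : Vec Bool m → Bool)
    → (T : Matrix (m + m)) → Invertible T
    → HomBent d (hMMT m π φ T)
    → IsSubspace m (Omega m d π φ T)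
mainTheorem5 m d _ π π-bij φ T T-inv (h-hom , _) =
  isSubspace-resp-⇔ m Ω⇔pullback-homogeneous (pullback-homogeneous-isSubspace m d L)
  where
  L : Vec Bool (m + m) → Vec Bool m
  L z = drop m (vecMat z T)
  perturb : (ω : Vec Bool m → Bool) (z : Vec Bool (m + m)) →
    hMMT m π (λ y → φ y xor ω y) T z ≡ hMMT m π φ T z xor ω (L z)
  perturb ω z = sym (xor-assoc (ip (take m (vecMat z T)) (π (L z))) (φ (L z)) (ω (L z)))
  Ω⇔pullback-homogeneous : (ω : Vec Bool m → Bool) → Homogeneous d (ω ∘ L) ⇔ Omega m d π φ T ω
  Ω⇔pullback-homogeneous ω = mk⇔
    (λ ω-hom → homogeneous-cong d (sym ∘ perturb ω) (homogeneous-xor d h-hom ω-hom)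
             , hMMT-bent m π π-bij (λ y → φ y xor ω y) T T-inv)
    (λ (hω-hom , _) → homogeneous-cancelˡ d h-hom (homogeneous-cong d (perturb ω) hω-hom))
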